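{- Let $A=\{a_1,\dots,a_t\}\subset\mathbb{N}_0$, $a_1<\dots<a_t$, be a finite 3-free set and $S(A)$ the Stanley sequence generated by $A$. If $n>\max A$ is an integer, then $H(S(A),n)=0$ if and only if $n\in S(A)$.
   Context: $\mathbb{N}_0$ denotes the set of nonnegative integers. A subset of $\mathbb{N}_0$ is 3-free if it contains no three-term arithmetic progression. Given a finite 3-free set $A=\{a_1,\dots,a_t\}\subset\mathbb{N}_0$ with $a_1<\dots<a_t$, the Stanley sequence generated by $A$ is the infinite sequence $S(A)=\{a_1,a_2,a_3,\dots\}$ defined recursively: for $k\ge t$, once $a_1<\dots<a_k$ are defined, $a_{k+1}$ is the smallest integer $a>a_k$ such that $\{a_1,\dots,a_k\}\cup\{a\}$ is 3-free. For $S\subset\mathbb{N}_0$ and an integer $n$, $H(S,n)=\#\{(s_1,s_2): s_1,s_2\in S,\ s_1<s_2,\ n=2s_2-s_1\}$. -}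

module Defs where

open import Data.Nat using (ℕ; zero; suc; _+_; _*_; _<_; _⊔_; _≡ᵇ_; _<ᵇ_)
open import Data.Bool using (Bool; true; false; if_then_else_; not; _∧_)
open import Data.List using (List; []; _∷_; _++_; foldr)
open import Data.Bool.ListAction using (any)
open import Data.List.Membership.Propositional using (_∈_)
open import Data.Product using (∃-syntax; _×_)
open import Relation.Binary.PropositionalEquality using (_≡_)
open import Relation.Nullary using (¬_)

ThreeFree : (ℕ → Set) → Set
ThreeFree P = ∀ x y z → P x → P y → P z → x < y → y < z → ¬ (x + z ≡ 2 * y)

-- maximum of a list of naturals (used only for nonempty lists)
maxL : List ℕ → ℕ
maxL = foldr _⊔_ 0

-- canAdd xs a = true iff no x < y in xs with x + a = 2y,
-- i.e. a (assumed larger than all of xs) creates no 3-term AP with xs.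
canAdd : List ℕ → ℕ → Bool
canAdd xs a = not (any (λ y → any (λ x → (x <ᵇ y) ∧ ((x + a) ≡ᵇ (2 * y))) xs) xs)

search : List ℕ → ℕ → ℕ → ℕ
search xs zero    a = a
search xs (suc f) a = if canAdd xs a then a else search xs f (suc a)

-- the next Stanley term after xs (whose largest element is m = maxL xs):
-- the least a > m such that xs ∪ {a} is 3-free.  Candidates m+1, …, 2m+1
-- are tried; 2m+1 always succeeds (x + 2m+1 > 2m ≥ 2y), so the search is exact.
next : List ℕ → ℕ
next xs = search xs (suc (maxL xs)) (suc (maxL xs))

-- first (t + k) terms of the Stanley sequence generated by A = {a_1 < … < a_t}
stanley : List ℕ → ℕ → List ℕ
stanley A zero    = A
stanley A (suc k) = stanley A k ++ (next (stanley A k) ∷ [])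

InS : List ℕ → ℕ → Set
InS A n = ∃[ k ] (n ∈ stanley A k)

-- H(S, n) = 0 : there is no pair s1 < s2 in S with n = 2 s2 − s1
HZero : (ℕ → Set) → ℕ → Set
HZero S n = ¬ (∃[ s₁ ] ∃[ s₂ ] (S s₁ × S s₂ × s₁ < s₂ × n + s₁ ≡ 2 * s₂))

-- Say that a completes an AP with a list xs if x + a = 2y for some x < y
-- in xs.  The proof rests on two facts about the greedy construction.
--   (1) Exactness of the greedy step: next xs is larger than max xs, does not
--       complete an AP with xs, and every c with max xs < c < next xs does.
-- The maxima M k of the prefixes increase strictly, so any n > M 0 = max A
-- satisfies M k < n ≤ next (S k) for some k.  If n = next (S k) then n ∈ S(A);
-- otherwise n completes an AP with S k by (1), so H(S(A), n) ≠ 0.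
-- Conversely, in any 3-free set a member n is never 2s₂ − s₁ with s₁ < s₂.

module Submission where

open import Defs
open import Data.Nat using (ℕ; zero; suc; z≤n; s≤s; _+_; _*_; _<_; _≤_; _⊔_; _≡ᵇ_; _<ᵇ_; _≤′_; ≤′-refl; ≤′-step; _≤?_; _<?_)
open import Data.Nat.Properties
open import Data.Bool using (Bool; true; false; _∧_; T)
open import Data.Bool.Properties using (T-∧; T-≡; T-not-≡; not-injective)
open import Data.Bool.ListAction using (any)
open import Data.List using (List; []; _∷_; _++_; [_])
open import Data.List.Relation.Unary.Any using (here; there)
open import Data.List.Relation.Unary.Any.Properties using (any⁺; any⁻)
open import Data.List.Relation.Unary.AllPairs using (AllPairs)
open import Data.List.Membership.Propositional using (_∈_; find; lose)
open import Data.List.Membership.Propositional.Properties using (∈-++⁻; ∈-++⁺ˡ; ∈-++⁺ʳ)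
open import Data.Product using (∃-syntax; _×_; _,_)
open import Data.Sum using (_⊎_; inj₁; inj₂)
open import Data.Empty using (⊥-elim)
open import Relation.Nullary using (¬_; yes; no)
open import Relation.Binary.PropositionalEquality using (_≡_; _≢_; refl; sym; trans; cong; subst; module ≡-Reasoning)
open import Function.Bundles using (_⇔_; mk⇔; Equivalence)

CompletesAP : List ℕ → ℕ → Set
CompletesAP xs a = ∃[ x ] ∃[ y ] (x ∈ xs × y ∈ xs × x < y × x + a ≡ 2 * y)

-- Boolean reflection of CompletesAP: canAdd xs a is by definition
-- not (hasAP xs a), and hasAP decides CompletesAP.

apPair : ℕ → ℕ → ℕ → Bool
apPair a y x = (x <ᵇ y) ∧ (x + a ≡ᵇ 2 * y)

hasAP : List ℕ → ℕ → Bool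
hasAP xs a = any (λ y → any (apPair a y) xs) xs

hasAP-complete : ∀ {xs a} → CompletesAP xs a → T (hasAP xs a)
hasAP-complete (x , y , x∈ , y∈ , x<y , eq) =
  any⁺ _ (lose y∈ (any⁺ _ (lose x∈ (Equivalence.from T-∧ (<⇒<ᵇ x<y , ≡⇒≡ᵇ _ _ eq)))))

hasAP-sound : ∀ xs a → T (hasAP xs a) → CompletesAP xs a
hasAP-sound xs a t with find (any⁻ _ xs t)
... | y , y∈ , t′ with find (any⁻ _ xs t′)
... | x , x∈ , t″ with Equivalence.to T-∧ t″
... | x<ᵇy , eq = x , y , x∈ , y∈ , <ᵇ⇒< x y x<ᵇy , ≡ᵇ⇒≡ _ _ eq

canAdd-true : ∀ xs a → canAdd xs a ≡ true → ¬ CompletesAP xs a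
canAdd-true xs a e c =
  subst T (Equivalence.to T-not-≡ (Equivalence.from T-≡ e)) (hasAP-complete c)

canAdd-false : ∀ xs a → canAdd xs a ≡ false → CompletesAP xs a
canAdd-false xs a e = hasAP-sound xs a (Equivalence.from T-≡ (not-injective e))

∈⇒≤maxL : ∀ {x xs} → x ∈ xs → x ≤ maxL xs
∈⇒≤maxL {xs = y ∷ ys} (here refl) = m≤m⊔n y (maxL ys)
∈⇒≤maxL {xs = y ∷ ys} (there x∈) = ≤-trans (∈⇒≤maxL x∈) (m≤n⊔m y (maxL ys))

maxL-snoc : ∀ xs {a} → maxL (xs ++ [ a ]) ≡ maxL xs ⊔ a
maxL-snoc []       {a} = ⊔-identityʳ a
maxL-snoc (y ∷ ys) {a} = trans (cong (y ⊔_) (maxL-snoc ys)) (sym (⊔-assoc y (maxL ys) a))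

large⇒¬CompletesAP : ∀ xs a → 2 * maxL xs < a → ¬ CompletesAP xs a
large⇒¬CompletesAP xs a lt (x , y , _ , y∈ , _ , eq) = <-irrefl refl (begin-strict
  2 * y       ≤⟨ *-monoʳ-≤ 2 (∈⇒≤maxL y∈) ⟩
  2 * maxL xs <⟨ lt ⟩
  a           ≤⟨ m≤n+m a x ⟩
  x + a       ≡⟨ eq ⟩
  2 * y       ∎)
  where open ≤-Reasoning

search-≥ : ∀ xs f a → a ≤ search xs f a
search-≥ xs zero    a = ≤-refl
search-≥ xs (suc f) a with canAdd xs a
... | true  = ≤-refl
... | false = ≤-trans (n≤1+n a) (search-≥ xs f (suc a))

search-free : ∀ xs f a → 2 * maxL xs < a + f → ¬ CompletesAP xs (search xs f a)
search-free xs zero    a lt = large⇒¬CompletesAP xs a (subst (2 * maxL xs <_) (+-identityʳ a) lt)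
search-free xs (suc f) a lt with canAdd xs a in e
... | true  = canAdd-true xs a e
... | false = search-free xs f (suc a) (subst (2 * maxL xs <_) (+-suc a f) lt)

search-skipped : ∀ xs f a c → a ≤ c → c < search xs f a → CompletesAP xs c
search-skipped xs zero    a c a≤c c< = ⊥-elim (<-irrefl refl (≤-<-trans a≤c c<))
search-skipped xs (suc f) a c a≤c c< with canAdd xs a in e
... | true  = ⊥-elim (<-irrefl refl (≤-<-trans a≤c c<))
... | false with m≤n⇒m<n∨m≡n a≤c
...   | inj₂ refl = canAdd-false xs a e
...   | inj₁ a<c  = search-skipped xs f (suc a) c a<c c<

-- (1) Exactness of the greedy step: the fuel suc m starting at suc m reaches
-- 2m + 2 > 2m, so the search never runs out before finding a valid term.

next-> : ∀ xs → maxL xs < next xs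
next-> xs = search-≥ xs (suc (maxL xs)) (suc (maxL xs))

next-free : ∀ xs → ¬ CompletesAP xs (next xs)
next-free xs = search-free xs (suc m) (suc m) 2m<2m+2
  where
  m = maxL xs
  2m<2m+2 : 2 * m < suc m + suc m
  2m<2m+2 = s≤s (+-monoʳ-≤ m (m≤n⇒m≤1+n (≤-reflexive (+-identityʳ m))))

next-least : ∀ xs c → maxL xs < c → c < next xs → CompletesAP xs c
next-least xs c = search-skipped xs (suc (maxL xs)) (suc (maxL xs)) c

snoc-below : ∀ xs {a w} → w ∈ xs ++ [ a ] → w < a → w ∈ xs
snoc-below xs w∈ w<a with ∈-++⁻ xs w∈
... | inj₁ w∈xs       = w∈xs
... | inj₂ (here refl) = ⊥-elim (<-irrefl refl w<a)

snoc-threeFree : ∀ xs a → ThreeFree (_∈ xs) → maxL xs < a → ¬ CompletesAP xs a →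
                 ThreeFree (_∈ xs ++ [ a ])
snoc-threeFree xs a tf max<a free x y z x∈ y∈ z∈ x<y y<z eq with ∈-++⁻ xs z∈
... | inj₁ z∈xs =
  tf x y z (snoc-below xs x∈ (<-trans x<y y<a)) (snoc-below xs y∈ y<a) z∈xs x<y y<z eq
  where
  y<a : y < a
  y<a = <-≤-trans y<z (≤-trans (∈⇒≤maxL z∈xs) (<⇒≤ max<a))
... | inj₂ (here refl) =
  free (x , y , snoc-below xs x∈ (<-trans x<y y<z) , snoc-below xs y∈ y<z , x<y , eq)

crossing : (f : ℕ → ℕ) → (∀ k → f k < f (suc k)) →
           ∀ n → f 0 < n → ∃[ k ] (f k < n × n ≤ f (suc k))
crossing f inc n f0<n with below n
  where
  unbounded : ∀ k → k ≤ f k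
  unbounded zero    = z≤n
  unbounded (suc k) = ≤-<-trans (unbounded k) (inc k)
  below : ∀ j → (∃[ k ] (f k < n × n ≤ f (suc k))) ⊎ (j ≤ f j × f j < n)
  below zero = inj₂ (z≤n , f0<n)
  below (suc j) with below j
  ... | inj₁ found = inj₁ found
  ... | inj₂ (_ , fj<n) with n ≤? f (suc j)
  ...   | yes n≤ = inj₁ (j , fj<n , n≤)
  ...   | no  n≰ = inj₂ (unbounded (suc j) , ≰⇒> n≰)
... | inj₁ found          = found
... | inj₂ (n≤fn , fn<n) = ⊥-elim (<-irrefl refl (≤-<-trans n≤fn fn<n))

threeFree⇒HZero : ∀ {P : ℕ → Set} → ThreeFree P → ∀ {n} → P n → HZero P n
threeFree⇒HZero tf {n} Pn (s₁ , s₂ , Ps₁ , Ps₂ , s₁<s₂ , eq) =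
  tf s₁ s₂ n Ps₁ Ps₂ Pn s₁<s₂ s₂<n (trans (+-comm s₁ n) eq)
  where
  s₂<n : s₂ < n
  s₂<n with s₂ <? n
  ... | yes s₂<n = s₂<n
  ... | no  s₂≮n = ⊥-elim (<-irrefl (trans eq (cong (s₂ +_) (+-identityʳ s₂)))
                                    (+-mono-≤-< (≮⇒≥ s₂≮n) s₁<s₂))

module Prefixes (A : List ℕ) where

  S : ℕ → List ℕ
  S = stanley A

  M : ℕ → ℕ
  M k = maxL (S k)

  M-suc : ∀ k → M (suc k) ≡ next (S k)
  M-suc k = begin
    maxL (S k ++ [ next (S k) ]) ≡⟨ maxL-snoc (S k) ⟩
    M k ⊔ next (S k)             ≡⟨ m≤n⇒m⊔n≡n (<⇒≤ (next-> (S k))) ⟩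
    next (S k)                   ∎
    where open ≡-Reasoning

  M-increasing : ∀ k → M k < M (suc k)
  M-increasing k = subst (M k <_) (sym (M-suc k)) (next-> (S k))

  S-mono : ∀ {k K x} → k ≤′ K → x ∈ S k → x ∈ S K
  S-mono ≤′-refl         x∈ = x∈
  S-mono (≤′-step k≤′K) x∈ = ∈-++⁺ˡ (S-mono k≤′K x∈)

  S-threeFree : ThreeFree (_∈ A) → ∀ k → ThreeFree (_∈ S k)
  S-threeFree tf zero    = tf
  S-threeFree tf (suc k) =
    snoc-threeFree (S k) (next (S k)) (S-threeFree tf k) (next-> (S k)) (next-free (S k))

  -- Three members of S(A) lie in a common prefix.
  InS-threeFree : ThreeFree (_∈ A) → ThreeFree (InS A)
  InS-threeFree tf x y z (k₁ , x∈) (k₂ , y∈) (k₃ , z∈) =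
    S-threeFree tf K x y z (lift (≤-trans (m≤m⊔n k₁ k₂) (m≤m⊔n (k₁ ⊔ k₂) k₃)) x∈)
                           (lift (≤-trans (m≤n⊔m k₁ k₂) (m≤m⊔n (k₁ ⊔ k₂) k₃)) y∈)
                           (lift (m≤n⊔m (k₁ ⊔ k₂) k₃) z∈)
    where
    K = k₁ ⊔ k₂ ⊔ k₃
    lift : ∀ {k w} → k ≤ K → w ∈ S k → w ∈ S K
    lift k≤K = S-mono (≤⇒≤′ k≤K)

open Prefixes using (S; M; M-suc; M-increasing; InS-threeFree)

lemma1 : (A : List ℕ) → A ≢ [] → AllPairs _<_ A → ThreeFree (_∈ A) →
         (n : ℕ) → maxL A < n → (HZero (InS A) n ⇔ InS A n)
lemma1 A _ _ tf n max<n = mk⇔ member (threeFree⇒HZero (InS-threeFree A tf))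
  where
  member : HZero (InS A) n → InS A n
  member H with crossing (M A) (M-increasing A) n max<n
  ... | k , Mk<n , n≤M′ with m≤n⇒m<n∨m≡n (subst (n ≤_) (M-suc A k) n≤M′)
  ...   | inj₂ n≡next = suc k , ∈-++⁺ʳ (S A k) (here n≡next)
  ...   | inj₁ n<next with next-least (S A k) n Mk<n n<next
  ...     | x , y , x∈ , y∈ , x<y , eq =
              ⊥-elim (H (x , y , (k , x∈) , (k , y∈) , x<y , trans (+-comm n x) eq))
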